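{- Let $L$ be a bounded lattice and $\to$ a preconditional on $L$. Let $P=\{(x,x\to y)\mid x,y\in L\}$ and define $\vartriangleleft$ on $P$ by $(a,b)\vartriangleleft(c,d)$ iff $c\not\le b$. Then there is a complete embedding of $(L,\to)$ into $(\mathfrak{L}(P,\vartriangleleft),\twoheadrightarrow_\vartriangleleft)$, which is an isomorphism if $L$ is complete.
   Context: A preconditional on a bounded lattice $L$ is a binary operation $\to$ such that for all $a,b,c$: (1) $1\to a\le a$; (2) $a\wedge b\le a\to b$; (3) $a\to b\le a\to(a\wedge b)$; (4) if $b\le a$ then $a\to(b\to c)\le b\to c$; (5) if $b\le c$ then $a\to b\le a\to c$. For a nonempty set $X$ with binary relation $\vartriangleleft$ (write $y\vartriangleright x$ for $x\vartriangleleft y$): $c_\vartriangleleft(A)=\{x\mid\forall x'\vartriangleleft x\ \exists x''\vartriangleright x':x''\in A\}$; $\mathfrak{L}(X,\vartriangleleft)$ is the complete lattice of $c_\vartriangleleft$-fixpoints ordered by inclusion (meets are intersections, joins are $c_\vartriangleleft$ of unions); $A\twoheadrightarrow_\vartriangleleft B=\{x\mid\forall y\vartriangleleft x\,(y\in A\Rightarrow\exists z\vartriangleright y: z\in A\cap B)\}$. A complete embedding is an injective map preserving all existing meets and joins and commuting with the extra operation(s). -}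

module Defs where

open import Level using (Level; _⊔_) renaming (suc to lsuc)
open import Relation.Binary.Lattice.Bundles using (BoundedLattice)
open import Data.Product using (Σ; ∃; ∃₂; _×_; _,_; proj₁; proj₂)
open import Relation.Nullary using (¬_)
open import Relation.Unary using (Pred; _∈_; _⊆_)
open import Algebra.Core using (Op₂)

module RelLattice {ℓ : Level} {X : Set ℓ} (_◁_ : X → X → Set ℓ) where

  cl : ∀ {ℓA} → Pred X ℓA → Pred X (ℓ ⊔ ℓA)
  cl A x = ∀ x' → x' ◁ x → ∃ λ x'' → (x' ◁ x'') × x'' ∈ A

  _↠_ : Pred X ℓ → Pred X ℓ → Pred X ℓ
  (A ↠ B) x = ∀ y → y ◁ x → y ∈ A → ∃ λ z → (y ◁ z) × (z ∈ A × z ∈ B)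

  _≐_ : ∀ {ℓ₁ ℓ₂} → Pred X ℓ₁ → Pred X ℓ₂ → Set _
  A ≐ B = (A ⊆ B) × (B ⊆ A)

  IsFixpoint : Pred X ℓ → Set ℓ
  IsFixpoint A = cl A ≐ A

  𝔏 : Set (lsuc ℓ)
  𝔏 = Σ (Pred X ℓ) IsFixpoint

module _ {ℓ : Level} (L : BoundedLattice ℓ ℓ ℓ) where
  open BoundedLattice L

  record IsPreconditional (_⇒_ : Op₂ Carrier) : Set ℓ where
    field
      ⇒-cong : ∀ {a a' b b'} → a ≈ a' → b ≈ b' → (a ⇒ b) ≈ (a' ⇒ b')
      pc1 : ∀ a → (⊤ ⇒ a) ≤ a
      pc2 : ∀ a b → (a ∧ b) ≤ (a ⇒ b)
      pc3 : ∀ a b → (a ⇒ b) ≤ (a ⇒ (a ∧ b))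
      pc4 : ∀ a b c → b ≤ a → (a ⇒ (b ⇒ c)) ≤ (b ⇒ c)
      pc5 : ∀ a b c → b ≤ c → (a ⇒ b) ≤ (a ⇒ c)

  IsLub : Pred Carrier ℓ → Carrier → Set ℓ
  IsLub S j = (∀ s → s ∈ S → s ≤ j) × (∀ u → (∀ s → s ∈ S → s ≤ u) → j ≤ u)

  IsGlb : Pred Carrier ℓ → Carrier → Set ℓ
  IsGlb S m = (∀ s → s ∈ S → m ≤ s) × (∀ u → (∀ s → s ∈ S → u ≤ s) → u ≤ m)

  IsComplete : Set (lsuc ℓ)
  IsComplete = ∀ (S : Pred Carrier ℓ) → (∃ (IsLub S)) × (∃ (IsGlb S))

  module _ (_⇒_ : Op₂ Carrier) where

    P : Set ℓ
    P = Σ (Carrier × Carrier) λ ab → ∃₂ λ x y → (proj₁ ab ≈ x) × (proj₂ ab ≈ (x ⇒ y))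

    _◁_ : P → P → Set ℓ
    ((a , b) , _) ◁ ((c , d) , _) = ¬ (c ≤ b)

    open RelLattice _◁_ public

    record IsCompleteEmbedding (f : Carrier → 𝔏) : Set (lsuc ℓ) where
      field
        injective : ∀ x y → proj₁ (f x) ≐ proj₁ (f y) → x ≈ y
        -- existing meets go to meets of 𝔏 (intersections)
        pres-meets : ∀ (S : Pred Carrier ℓ) m → IsGlb S m →
          proj₁ (f m) ≐ (λ p → ∀ s → s ∈ S → p ∈ proj₁ (f s))
        -- existing joins go to joins of 𝔏 (closure of unions)
        pres-joins : ∀ (S : Pred Carrier ℓ) j → IsLub S j →
          proj₁ (f j) ≐ cl (λ p → ∃ λ s → s ∈ S × p ∈ proj₁ (f s))
        pres-⇒ : ∀ x y → proj₁ (f (x ⇒ y)) ≐ (proj₁ (f x) ↠ proj₁ (f y))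

    IsSurjective : (Carrier → 𝔏) → Set (lsuc ℓ)
    IsSurjective f = ∀ (A : 𝔏) → ∃ λ x → proj₁ (f x) ≐ proj₁ A

{-# OPTIONS --safe #-}
module Submission where

open import Defs hiding (cl; _↠_; _≐_)
open import Level using (Level)
open import Relation.Binary.Lattice.Bundles using (BoundedLattice)
open import Data.Product using (Σ; ∃; _×_; _,_; proj₁; proj₂; swap)
open import Algebra.Core using (Op₂)
open import Axiom.ExcludedMiddle using (ExcludedMiddle)
open import Axiom.DoubleNegationElimination using (em⇒dne)
open import Relation.Nullary using (¬_)
open import Relation.Unary using (Pred; _∈_; _⊆_)

-- Send x to the principal downset ↓x = {(a , b) ∈ P | a ≤ x}.
-- Since (a , b) ◁ (c , d) depends only on b and c, a point lies in cl A iff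
-- its first coordinate lies below every b that some first coordinate of A
-- escapes; classically this says that cl A is ↓j for the supremum j of the
-- first coordinates of A, whenever that supremum exists.  This one fact gives
-- that each ↓x is closed, that joins are preserved and, when L is complete,
-- that every closed set is some ↓j.  Meets and injectivity are immediate, and
-- ↓(x ⇒ y) = ↓x ↠ ↓y follows from axioms (2)–(5), the witness of ↓x ↠ ↓y
-- being the point (x ∧ y , (x ∧ y) ⇒ (x ∧ y)).

module PreconditionalProperties {ℓ : Level} (L : BoundedLattice ℓ ℓ ℓ)
  {_⇒_ : Op₂ (BoundedLattice.Carrier L)} (pc : IsPreconditional L _⇒_) where
  open BoundedLattice L
  open IsPreconditional pc

  ≤-⊤⇒ : ∀ x → x ≤ (⊤ ⇒ x)
  ≤-⊤⇒ x = trans (∧-greatest (maximum x) refl) (pc2 ⊤ x)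

  ⇒-≤-⇒ : ∀ {x y a b} → a ≤ x → (x ∧ y) ≤ (a ⇒ b) → (x ⇒ y) ≤ (a ⇒ b)
  ⇒-≤-⇒ {x} {y} {a} {b} a≤x x∧y≤a⇒b =
    trans (pc3 x y) (trans (pc5 x (x ∧ y) (a ⇒ b) x∧y≤a⇒b) (pc4 x a b a≤x))

module Representation {ℓ : Level} (em : ExcludedMiddle ℓ) (L : BoundedLattice ℓ ℓ ℓ)
  (_⇒_ : Op₂ (BoundedLattice.Carrier L)) (pc : IsPreconditional L _⇒_) where
  open BoundedLattice L
  open IsPreconditional pc
  open PreconditionalProperties L pc
  open RelLattice (_◁_ L _⇒_) using (cl; _↠_; _≐_)

  dne : {Q : Set ℓ} → ¬ ¬ Q → Q
  dne = em⇒dne em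

  fst snd : P L _⇒_ → Carrier
  fst p = proj₁ (proj₁ p)
  snd p = proj₂ (proj₁ p)

  point : Carrier → Carrier → P L _⇒_
  point x y = (x , x ⇒ y) , x , y , Eq.refl , Eq.refl

  snd-≈-fst⇒ : ∀ p → ∃ λ y → snd p ≈ (fst p ⇒ y)
  snd-≈-fst⇒ (_ , _ , y , a≈x , b≈x⇒y) = y , Eq.trans b≈x⇒y (⇒-cong (Eq.sym a≈x) Eq.refl)

  ↓ : Carrier → Pred (P L _⇒_) ℓ
  ↓ x p = fst p ≤ x

  fsts : Pred (P L _⇒_) ℓ → Pred Carrier ℓ
  fsts A a = ∃ λ p → p ∈ A × a ≈ fst p

  cl-≐-↓ : ∀ {A j} → IsLub L (fsts A) j → cl A ≐ ↓ j
  cl-≐-↓ {A} {j} (upper , least) = (λ {p} → cl⊆↓ {p}) , (λ {p} → ↓⊆cl {p})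
    where
    fst≤j : ∀ {z} → z ∈ A → fst z ≤ j
    fst≤j {z} z∈A = upper (fst z) (z , z∈A , Eq.refl)

    -- The test point (⊤ , ⊤ ⇒ j) is ◁-below exactly the points whose first
    -- coordinate is not below j, by pc1 and pc2.
    cl⊆↓ : cl A ⊆ ↓ j
    cl⊆↓ {p} p∈clA = dne λ p≰j →
      let (z , z◁ , z∈A) = p∈clA (point ⊤ j) (λ p≤⊤⇒j → p≰j (trans p≤⊤⇒j (pc1 j)))
      in z◁ (trans (fst≤j z∈A) (≤-⊤⇒ j))

    ↓⊆cl : ↓ j ⊆ cl A
    ↓⊆cl {p} p≤j q p≰q = dne λ noWitness →
      p≰q (trans p≤j (least (snd q) λ { a (z , z∈A , a≈z) →
        trans (reflexive a≈z) (dne λ z≰q → noWitness (z , z≰q , z∈A)) }))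

  ↓-isFixpoint : ∀ x → IsFixpoint L _⇒_ (↓ x)
  ↓-isFixpoint x = cl-≐-↓ (upper , least)
    where
    upper : ∀ a → a ∈ fsts (↓ x) → a ≤ x
    upper a (p , p≤x , a≈p) = trans (reflexive a≈p) p≤x

    least : ∀ u → (∀ a → a ∈ fsts (↓ x) → a ≤ u) → x ≤ u
    least u bound = bound x (point x x , refl , Eq.refl)

  ↓-closed : Carrier → 𝔏 L _⇒_
  ↓-closed x = ↓ x , ↓-isFixpoint x

  ↓-injective : ∀ x y → ↓ x ≐ ↓ y → x ≈ y
  ↓-injective x y (x⊆y , y⊆x) = antisym (x⊆y {point x x} refl) (y⊆x {point y y} refl)

  ↓-meet : ∀ S m → IsGlb L S m → ↓ m ≐ (λ p → ∀ s → s ∈ S → p ∈ ↓ s)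
  ↓-meet S m (lower , greatest) =
    (λ p≤m s s∈S → trans p≤m (lower s s∈S)) , (λ {p} p≤S → greatest (fst p) p≤S)

  ↓-join : ∀ S j → IsLub L S j → ↓ j ≐ cl (λ p → ∃ λ s → s ∈ S × p ∈ ↓ s)
  ↓-join S j (upper , least) = swap (cl-≐-↓ (upper′ , least′))
    where
    upper′ : ∀ a → a ∈ fsts (λ p → ∃ λ s → s ∈ S × p ∈ ↓ s) → a ≤ j
    upper′ a (p , (s , s∈S , p≤s) , a≈p) = trans (reflexive a≈p) (trans p≤s (upper s s∈S))

    least′ : ∀ u → (∀ a → a ∈ fsts (λ p → ∃ λ s → s ∈ S × p ∈ ↓ s) → a ≤ u) → j ≤ u
    least′ u bound = least u λ s s∈S → bound s (point s s , (s , s∈S , refl) , Eq.refl)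

  ↓-⇒ : ∀ x y → ↓ (x ⇒ y) ≐ (↓ x ↠ ↓ y)
  ↓-⇒ x y = (λ {p} → ⊆↠ {p}) , (λ {p} → ↠⊆ {p})
    where
    ⊆↠ : ↓ (x ⇒ y) ⊆ (↓ x ↠ ↓ y)
    ⊆↠ {p} p≤x⇒y q p≰q q≤x =
      point (x ∧ y) (x ∧ y) , x∧y≰q , x∧y≤x x y , x∧y≤y x y
      where
      x∧y≰q : ¬ (x ∧ y ≤ snd q)
      x∧y≰q x∧y≤q =
        let (_ , q≈) = snd-≈-fst⇒ q
        in p≰q (trans p≤x⇒y (trans (⇒-≤-⇒ q≤x (trans x∧y≤q (reflexive q≈)))
                                   (reflexive (Eq.sym q≈))))

    ↠⊆ : (↓ x ↠ ↓ y) ⊆ ↓ (x ⇒ y)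
    ↠⊆ {p} p∈↠ = dne λ p≰x⇒y →
      let (z , z≰x⇒y , z≤x , z≤y) = p∈↠ (point x y) p≰x⇒y refl
      in z≰x⇒y (trans (∧-greatest z≤x z≤y) (pc2 x y))

  ↓-isCompleteEmbedding : IsCompleteEmbedding L _⇒_ ↓-closed
  ↓-isCompleteEmbedding = record
    { injective  = ↓-injective
    ; pres-meets = ↓-meet
    ; pres-joins = ↓-join
    ; pres-⇒     = ↓-⇒
    }

  ↓-surjective : IsComplete L → IsSurjective L _⇒_ ↓-closed
  ↓-surjective complete (A , (clA⊆A , A⊆clA)) =
    let (j , j-isLub) = proj₁ (complete (fsts A))
        (clA⊆↓j , ↓j⊆clA) = cl-≐-↓ j-isLub
    in j , (λ {p} p∈↓j → clA⊆A (↓j⊆clA {p} p∈↓j)) , (λ {p} p∈A → clA⊆↓j {p} (A⊆clA {p} p∈A))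

theorem6p3 : ∀ {ℓ : Level} → ExcludedMiddle ℓ →
    (L : BoundedLattice ℓ ℓ ℓ) (_⇒_ : Op₂ (BoundedLattice.Carrier L)) →
    IsPreconditional L _⇒_ →
    Σ (BoundedLattice.Carrier L → 𝔏 L _⇒_) λ f →
    IsCompleteEmbedding L _⇒_ f × (IsComplete L → IsSurjective L _⇒_ f)
theorem6p3 em L _⇒_ pc = ↓-closed , ↓-isCompleteEmbedding , ↓-surjective
  where open Representation em L _⇒_ pc
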